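{- Let $q\ge0$, $t\ge1$ be integers. The set $\mathcal{L}(q,t)$ is a regular language (i.e. it is the set of words accepted by some deterministic finite automaton).
   Context: Consider the automaton $M_G$ over the alphabet $\{0,1,\dots,q+t\}$ with states $A,B,C$ and transitions: from $A$ or from $B$, a letter in $\{1+q,\dots,q+t\}$ leads to $A$, a letter in $\{1,\dots,q\}$ leads to $B$, and the letter $0$ leads to $C$; from $C$, a letter in $\{1+q,\dots,q+t\}$ leads to $A$, the letter $q$ leads to $C$, and all other letters are rejected. $\mathcal{L}(q,t)$ is the set of words $\omega$ for which there is a state $s\in\{A,B,C\}$ such that reading $\omega$ starting from $s$ accepts every letter, ends in state $s$, and passes through state $A$ at some point. -}

module Defs where

open import Data.Nat using (ℕ; zero; suc; _+_; _≤_; _<_; _≟_; _<?_)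
open import Data.Fin using (Fin; toℕ)
open import Data.List using (List; []; _∷_; last)
open import Data.Maybe using (Maybe; just; nothing)
open import Data.Bool using (Bool; true)
open import Data.Product using (Σ; ∃; _×_; _,_)
open import Data.List.Membership.Propositional using (_∈_)
open import Relation.Nullary using (yes; no)
open import Relation.Binary.PropositionalEquality using (_≡_)

data State : Set where
  A B C : State

Letter : ℕ → ℕ → Set
Letter q t = Fin (suc (q + t))

-- Partial transition function of M_G (nothing = letter rejected).
-- Letters in {1+q,...,q+t} are exactly those with q < a.
δ : (q t : ℕ) → State → Letter q t → Maybe State
δ q t s a with q <? toℕ a
δ q t s a | yes _ = just A
δ q t A a | no _ with toℕ a ≟ 0
... | yes _ = just C
... | no _  = just B
δ q t B a | no _ with toℕ a ≟ 0
... | yes _ = just C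
... | no _  = just B
δ q t C a | no _ with toℕ a ≟ q
... | yes _ = just C
... | no _  = nothing

trace : (q t : ℕ) → State → List (Letter q t) → Maybe (List State)
trace q t s [] = just (s ∷ [])
trace q t s (a ∷ w) with δ q t s a
... | nothing = nothing
... | just s' with trace q t s' w
...   | nothing = nothing
...   | just ss = just (s ∷ ss)

inL : (q t : ℕ) → List (Letter q t) → Set
inL q t w = ∃ λ (s : State) → ∃ λ (ss : List State) →
  (trace q t s w ≡ just ss) × (last ss ≡ just s) × (A ∈ ss)

record DFA (Sym : Set) : Set where
  field
    n      : ℕ
    start  : Fin n
    step   : Fin n → Sym → Fin n
    accept : Fin n → Bool

run : {Sym : Set} (M : DFA Sym) → Fin (DFA.n M) → List Sym → Fin (DFA.n M)
run M s [] = s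
run M s (a ∷ w) = run M (DFA.step M s a) w

Accepts : {Sym : Set} → DFA Sym → List Sym → Set
Accepts M w = DFA.accept M (run M (DFA.start M) w) ≡ true

-- A word ω lies in L(q,t) exactly when, for one of the three states s, the run of M_G from s
-- reads all of ω, returns to s and visits A. For a fixed s this is decided by running M_G
-- while remembering whether A has been visited (seven states: a dead state plus
-- State × Bool), so L(q,t) is a union of three regular languages, and regular languages
-- are closed under union by the product construction.
module Submission where

open import Defs
open import Data.Bool using (Bool; false; T; _∧_; _∨_)
open import Data.Bool.ListAction using (any)
open import Data.Bool.Properties using (T-≡; T-∧; T-∨; ∨-identityʳ; ∨-assoc)
open import Data.Fin using (Fin; zero; suc)
open import Data.Fin.Properties using (*↔×; 2↔Bool)
import Data.Fin.Properties as Fin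
open import Data.List using (List; []; _∷_; foldl; last)
open import Data.List.Membership.Propositional using (_∈_)
import Data.List.Relation.Unary.Any as Any
open import Data.List.Relation.Unary.Any.Properties using (any⇔)
open import Data.Maybe using (Maybe; just; nothing; _>>=_)
import Data.Maybe as Maybe
open import Data.Maybe.Properties using (just-injective)
open import Data.Nat using (ℕ; _*_; _≤_)
import Data.Nat as ℕ
open import Data.Product using (Σ; ∃; _×_; _,_; proj₁; proj₂)
open import Data.Product.Function.NonDependent.Propositional using (_×-↔_; _×-⇔_)
open import Data.Sum using (_⊎_; inj₁; inj₂)
open import Data.Sum.Function.Propositional using (_⊎-⇔_)
open import Function using (_∘_)
open import Function.Bundles using (_⇔_; mk⇔; _↔_; mk↔ₛ′; Inverse)
open import Function.Construct.Composition using (_↔-∘_; _⇔-∘_)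
open import Function.Construct.Symmetry using (↔-sym; ⇔-sym)
open import Function.Properties.Inverse using (↔⇒↣)
open import Relation.Binary.Definitions using (DecidableEquality)
open import Relation.Binary.PropositionalEquality using (_≡_; refl; sym; trans; cong; subst)
open import Relation.Nullary.Decidable using (⌊_⌋; via-injection; toWitness; fromWitness)

Maybe↔Fin : {X : Set} {n : ℕ} → X ↔ Fin n → Maybe X ↔ Fin (ℕ.suc n)
Maybe↔Fin {X} {n} X↔Fin = mk↔ₛ′ to′ from′ to-from from-to
  where
  open Inverse X↔Fin
  to′ : Maybe X → Fin (ℕ.suc n)
  to′ nothing  = zero
  to′ (just x) = suc (to x)
  from′ : Fin (ℕ.suc n) → Maybe X
  from′ zero    = nothing
  from′ (suc i) = just (from i)
  to-from : ∀ i → to′ (from′ i) ≡ i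
  to-from zero    = refl
  to-from (suc i) = cong suc (strictlyInverseˡ i)
  from-to : ∀ x → from′ (to′ x) ≡ x
  from-to nothing  = refl
  from-to (just x) = cong just (strictlyInverseʳ x)

×↔Fin : {X Y : Set} {m n : ℕ} → X ↔ Fin m → Y ↔ Fin n → (X × Y) ↔ Fin (m * n)
×↔Fin X↔Fin Y↔Fin = ↔-sym *↔× ↔-∘ (X↔Fin ×-↔ Y↔Fin)

module _ {Sym S : Set} {n : ℕ} (S↔Fin : S ↔ Fin n) where
  open Inverse S↔Fin

  finiteDFA : S → (S → Sym → S) → (S → Bool) → DFA Sym
  finiteDFA s₀ step accept = record
    { n = n ; start = to s₀ ; step = λ i a → to (step (from i) a) ; accept = accept ∘ from }

  module _ (s₀ : S) (step : S → Sym → S) (accept : S → Bool) where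
    run-finiteDFA : ∀ s w → run (finiteDFA s₀ step accept) (to s) w ≡ to (foldl step s w)
    run-finiteDFA s []      = refl
    run-finiteDFA s (a ∷ w) = trans (cong (λ s′ → run _ (to (step s′ a)) w) (strictlyInverseʳ s))
                                     (run-finiteDFA (step s a) w)

    Accepts-finiteDFA : ∀ w → Accepts (finiteDFA s₀ step accept) w ⇔ T (accept (foldl step s₀ w))
    Accepts-finiteDFA w rewrite run-finiteDFA s₀ w | strictlyInverseʳ (foldl step s₀ w) = ⇔-sym T-≡

module _ {Sym : Set} where
  open DFA

  productStep : (M N : DFA Sym) → Fin (n M) × Fin (n N) → Sym → Fin (n M) × Fin (n N)
  productStep M N (x , y) a = step M x a , step N y a

  eitherAccepts : (M N : DFA Sym) → Fin (n M) × Fin (n N) → Bool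
  eitherAccepts M N (x , y) = accept M x ∨ accept N y

  _∪_ : DFA Sym → DFA Sym → DFA Sym
  M ∪ N = finiteDFA (↔-sym *↔×) (start M , start N) (productStep M N) (eitherAccepts M N)

  run-product : ∀ M N x y w → foldl (productStep M N) (x , y) w ≡ (run M x w , run N y w)
  run-product M N x y []      = refl
  run-product M N x y (a ∷ w) = run-product M N (step M x a) (step N y a) w

  Accepts-∪ : ∀ M N w → Accepts (M ∪ N) w ⇔ (Accepts M w ⊎ Accepts N w)
  Accepts-∪ M N w = (T-≡ ⊎-⇔ T-≡) ⇔-∘ (T-∨ ⇔-∘ accepts-product)
    where
    accepts-product : Accepts (M ∪ N) w
                    ⇔ T (accept M (run M (start M) w) ∨ accept N (run N (start N) w))
    accepts-product = subst (λ b → Accepts (M ∪ N) w ⇔ T b)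
      (cong (eitherAccepts M N) (run-product M N (start M) (start N) w))
      (Accepts-finiteDFA (↔-sym *↔×) (start M , start N) (productStep M N) (eitherAccepts M N) w)

State↔Fin3 : State ↔ Fin 3
State↔Fin3 = mk↔ₛ′ to from to-from from-to
  where
  to : State → Fin 3
  to A = zero
  to B = suc zero
  to C = suc (suc zero)
  from : Fin 3 → State
  from zero             = A
  from (suc zero)       = B
  from (suc (suc zero)) = C
  to-from : ∀ i → to (from i) ≡ i
  to-from zero             = refl
  to-from (suc zero)       = refl
  to-from (suc (suc zero)) = refl
  from-to : ∀ s → from (to s) ≡ s
  from-to A = refl
  from-to B = refl
  from-to C = refl

_≟ˢ_ : DecidableEquality State
_≟ˢ_ = via-injection (↔⇒↣ State↔Fin3) Fin._≟_

isA : State → Bool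
isA s = ⌊ A ≟ˢ s ⌋

A∈⇔any-isA : ∀ ss → A ∈ ss ⇔ T (any isA ss)
A∈⇔any-isA ss = any⇔ ⇔-∘ mk⇔ (Any.map fromWitness) (Any.map toWitness)

extend : State × Bool → State → State × Bool
extend (_ , b) s = s , b ∨ isA s

last-foldl-extend : ∀ x b xs → last (x ∷ xs) ≡ just (proj₁ (foldl extend (x , b) xs))
last-foldl-extend x b []       = refl
last-foldl-extend x b (y ∷ ys) = last-foldl-extend y (b ∨ isA y) ys

flag-foldl-extend : ∀ x b xs → proj₂ (foldl extend (x , b) xs) ≡ b ∨ any isA xs
flag-foldl-extend x b []       = sym (∨-identityʳ b)
flag-foldl-extend x b (y ∷ ys) =
  trans (flag-foldl-extend y (b ∨ isA y) ys) (∨-assoc b (isA y) (any isA ys))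

ClosesThroughA : State → List State → Set
ClosesThroughA s ss = last ss ≡ just s × A ∈ ss

closes : State → State × Bool → Bool
closes s (x , b) = ⌊ x ≟ˢ s ⌋ ∧ b

closes-foldl-extend : ∀ s rest →
  T (closes s (foldl extend (s , isA s) rest)) ⇔ ClosesThroughA s (s ∷ rest)
closes-foldl-extend s rest = (returns ×-⇔ visitsA) ⇔-∘ T-∧
  where
  returns : T ⌊ proj₁ (foldl extend (s , isA s) rest) ≟ˢ s ⌋ ⇔ last (s ∷ rest) ≡ just s
  returns rewrite last-foldl-extend s (isA s) rest =
    mk⇔ (cong just ∘ toWitness) (fromWitness ∘ just-injective)
  visitsA : T (proj₂ (foldl extend (s , isA s) rest)) ⇔ A ∈ s ∷ rest
  visitsA rewrite flag-foldl-extend s (isA s) rest = ⇔-sym (A∈⇔any-isA (s ∷ rest))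

Summary↔Fin7 : Maybe (State × Bool) ↔ Fin 7
Summary↔Fin7 = Maybe↔Fin (×↔Fin State↔Fin3 (↔-sym 2↔Bool))

-- A nonempty path is summarised by its last state and whether it visits A; the flag b
-- must already account for the first state.
summarize : Bool → List State → Maybe (State × Bool)
summarize b []       = nothing
summarize b (x ∷ xs) = just (foldl extend (x , b) xs)

module _ (q t : ℕ) where

  trace-starts-at : ∀ p w {ss} → trace q t p w ≡ just ss → ∃ λ rest → ss ≡ p ∷ rest
  trace-starts-at p []      refl = [] , refl
  trace-starts-at p (a ∷ w) eq with δ q t p a
  ... | just p′ with trace q t p′ w
  ...   | just ss = ss , sym (just-injective eq)

  visit : Maybe (State × Bool) → Letter q t → Maybe (State × Bool)
  visit nothing  a = nothing
  visit (just x) a = Maybe.map (extend x) (δ q t (proj₁ x) a)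

  foldl-visit-nothing : ∀ w → foldl visit nothing w ≡ nothing
  foldl-visit-nothing []      = refl
  foldl-visit-nothing (a ∷ w) = foldl-visit-nothing w

  foldl-visit : ∀ p b w → foldl visit (just (p , b)) w ≡ (trace q t p w >>= summarize b)
  foldl-visit p b []      = refl
  foldl-visit p b (a ∷ w) with δ q t p a
  ... | nothing = foldl-visit-nothing w
  ... | just p′ with trace q t p′ w in eq | foldl-visit p′ (b ∨ isA p′) w
  ...   | nothing | ih = ih
  ...   | just ss | ih with trace-starts-at p′ w eq
  ...     | rest , refl = ih

  LoopsThroughA : State → List (Letter q t) → Set
  LoopsThroughA s w = ∃ λ ss → trace q t s w ≡ just ss × ClosesThroughA s ss

  closesFrom : State → Maybe (State × Bool) → Bool
  closesFrom s = Maybe.maybe (closes s) false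

  closesFrom-trace : ∀ s w →
    T (closesFrom s (trace q t s w >>= summarize (isA s))) ⇔ LoopsThroughA s w
  closesFrom-trace s w with trace q t s w in eq
  ... | nothing = mk⇔ (λ ()) (λ { (_ , () , _) })
  ... | just ss with trace-starts-at s w eq
  ...   | rest , refl =
    mk⇔ (λ c → _ , refl , c) (λ { (_ , refl , c) → c }) ⇔-∘ closes-foldl-extend s rest

  loopDFA : State → DFA (Letter q t)
  loopDFA s = finiteDFA Summary↔Fin7 (just (s , isA s)) visit (closesFrom s)

  Accepts-loopDFA : ∀ s w → Accepts (loopDFA s) w ⇔ LoopsThroughA s w
  Accepts-loopDFA s w = closesFrom-trace s w ⇔-∘
    subst (λ r → Accepts (loopDFA s) w ⇔ T (closesFrom s r)) (foldl-visit s (isA s) w)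
      (Accepts-finiteDFA Summary↔Fin7 (just (s , isA s)) visit (closesFrom s) w)

∃-State⇔⊎ : {P : State → Set} → (∃ P) ⇔ (P A ⊎ P B ⊎ P C)
∃-State⇔⊎ = mk⇔ (λ { (A , p) → inj₁ p ; (B , p) → inj₂ (inj₁ p) ; (C , p) → inj₂ (inj₂ p) })
                (λ { (inj₁ p) → A , p ; (inj₂ (inj₁ p)) → B , p ; (inj₂ (inj₂ p)) → C , p })

proposition9 : (q t : ℕ) → 1 ≤ t →
    Σ (DFA (Letter q t)) λ M → (w : List (Letter q t)) → Accepts M w ⇔ inL q t w
proposition9 q t _ = M A ∪ (M B ∪ M C) , λ w →
  ⇔-sym ∃-State⇔⊎ ⇔-∘
  ((loops A w ⊎-⇔ ((loops B w ⊎-⇔ loops C w) ⇔-∘ Accepts-∪ (M B) (M C) w))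
     ⇔-∘ Accepts-∪ (M A) (M B ∪ M C) w)
  where
  M : State → DFA (Letter q t)
  M = loopDFA q t
  loops : ∀ s w → Accepts (M s) w ⇔ LoopsThroughA q t s w
  loops = Accepts-loopDFA q t
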